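{- Let $\lambda$ be a partition with bead-set $X$ normalized with respect to $s$, and suppose the largest element of $X$ lies in row $q-1$ of the $s$-abacus. If the $s$-abacus of $\lambda$ exhibits both horizontal anti-symmetry and vertical symmetry, then $\lambda$ is self-conjugate.
   Context: For a partition $\lambda$ with first-column hook lengths $h_1>h_2>\dots$ and an integer $m\ge0$, $X=\{0,1,\dots,m-1\}\cup\{h_\gamma+m\}$ is a bead-set of $\lambda$; it is normalized with respect to $s$ if $m$ is minimal such that $|X|\equiv0\pmod s$. The $s$-abacus places each integer $x\ge0$ at runner $i=x\bmod s$ and row $j=\lfloor x/s\rfloor$, with a bead if $x\in X$, a spacer otherwise; positions are written $(i,j)$, $0\le i\le s-1$, $0\le j\le q-1$. Horizontal anti-symmetry: there is a bead at $(i,j)$ iff there is a spacer at $(i,q-1-j)$. Vertical symmetry: there is a bead at $(i,j)$ iff there is a bead at $(s-1-i,j)$. Self-conjugate means equal to its conjugate partition. -}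

module Defs where

open import Data.Nat using (ℕ; zero; suc; _+_; _*_; _∸_; _≤_; _<_; _≥_; _>_; _≤?_; NonZero)
open import Data.Nat.DivMod using (_/_; _%_)
open import Data.List using (List; []; _∷_; length; map; filter; upTo; _++_)
open import Data.List.Membership.Propositional using (_∈_)
open import Data.List.Relation.Unary.All using (All)
open import Data.List.Relation.Unary.Linked using (Linked)
open import Data.Product using (_×_; ∃-syntax)
open import Relation.Nullary using (¬_)
open import Relation.Binary.PropositionalEquality using (_≡_; _≢_)

IsPartition : List ℕ → Set
IsPartition λs = Linked _≥_ λs × All (λ a → a > 0) λs

-- First-column hook lengths h_1 > h_2 > ... : h_i = λ_i + (ℓ - i).
hooks : List ℕ → List ℕ
hooks []       = []
hooks (a ∷ as) = (a + length as) ∷ hooks as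

beadSet : ℕ → List ℕ → List ℕ
beadSet m λs = upTo m ++ map (_+ m) (hooks λs)

-- |X| = m + ℓ (the hook lengths are distinct and the two parts are disjoint).
-- m is minimal such that |X| ≡ 0 (mod s).
IsNormalizingShift : (s : ℕ) → .{{NonZero s}} → List ℕ → ℕ → Set
IsNormalizingShift s λs m =
  ((m + length λs) % s ≡ 0) × (∀ m' → m' < m → (m' + length λs) % s ≢ 0)

HasBead : (s : ℕ) → List ℕ → ℕ → ℕ → Set
HasBead s X i j = (i + j * s) ∈ X

LargestInRow : (s : ℕ) → .{{NonZero s}} → List ℕ → ℕ → Set
LargestInRow s X r = ∃[ x ] (x ∈ X × All (λ y → y ≤ x) X × x / s ≡ r)

HorizAntiSym : (s q : ℕ) → List ℕ → Set
HorizAntiSym s q X = ∀ i j → i < s → j < q →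
  (HasBead s X i j → ¬ HasBead s X i (q ∸ 1 ∸ j)) ×
  (¬ HasBead s X i (q ∸ 1 ∸ j) → HasBead s X i j)

VertSym : (s q : ℕ) → List ℕ → Set
VertSym s q X = ∀ i j → i < s → j < q →
  (HasBead s X i j → HasBead s X (s ∸ 1 ∸ i) j) ×
  (HasBead s X (s ∸ 1 ∸ i) j → HasBead s X i j)

conjugate : List ℕ → List ℕ
conjugate []         = []
conjugate (a ∷ as) = map (λ j → length (filter (λ b → suc j ≤? b) (a ∷ as))) (upTo a)

SelfConjugate : List ℕ → Set
SelfConjugate λs = conjugate λs ≡ λs

-- Read the positions qs − 1, …, 1, 0 of the abacus as a word of beads and spacers.
-- The parts of λ are the numbers of spacers below each bead, and the parts of its
-- conjugate are the numbers of beads above each spacer; so reversing the word and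
-- exchanging beads with spacers conjugates λ. The two symmetries of the abacus say
-- precisely that position x holds a bead iff position qs − 1 − x holds a spacer,
-- i.e. the word is its own reversed complement, hence λ is self-conjugate.
module Submission where

open import Data.Bool using (Bool; true; false; not)
open import Data.Empty.Irrelevant using (⊥-elim)
open import Data.List
  using (List; []; _∷_; [_]; _++_; length; map; filter; reverse; upTo; downFrom; applyUpTo; applyDownFrom)
open import Data.List.Properties
open import Data.List.Membership.Propositional using (_∈_; _∉_)
open import Data.List.Membership.Propositional.Properties
  using (∈-++⁺ˡ; ∈-++⁺ʳ; ∈-++⁻; ∈-upTo⁺; ∈-upTo⁻; ∈-downFrom⁺; ∈-downFrom⁻)
open import Data.List.Relation.Unary.All as All using (All; []; _∷_)
import Data.List.Relation.Unary.All.Properties as All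
open import Data.List.Relation.Unary.Any using (here; there)
open import Data.List.Relation.Unary.Linked as Linked using (Linked; []; [-]; _∷_)
import Data.List.Relation.Unary.Linked.Properties as Linked
open import Data.Nat
  using (ℕ; zero; suc; _+_; _*_; _∸_; _≤_; _<_; _≥_; _>_; _≤?_; _≟_; z≤n; s≤s; s≤s⁻¹; NonZero; ≢-nonZero⁻¹)
open import Data.Nat.Properties
open import Data.List.Membership.DecPropositional _≟_ using (_∈?_)
open import Data.Nat.DivMod using (_/_; _%_; m≡m%n+[m/n]*n; m%n<n; m<n*o⇒m/o<n)
open import Data.Nat.Tactic.RingSolver using (solve-∀)
open import Data.Product using (_×_; _,_; proj₁; proj₂)
open import Data.Sum using ([_,_]′)
open import Function using (_∘_; id; _⇔_; mk⇔; Equivalence)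
open import Relation.Binary.PropositionalEquality hiding ([_])
open import Relation.Nullary using (¬_; does; yes; no; ¬?; contradiction)
open import Relation.Nullary.Decidable using (dec-true; dec-false; does-⇔)

open import Defs

open ≡-Reasoning

dropZeros : List ℕ → List ℕ
dropZeros = filter (1 ≤?_)

countAbove : ℕ → List ℕ → ℕ
countAbove j μ = length (filter (λ b → suc j ≤? b) μ)

countAbove-map-suc : ∀ j μ → countAbove (suc j) (map suc μ) ≡ countAbove j μ
countAbove-map-suc j []      = refl
countAbove-map-suc j (b ∷ μ) with does (suc j ≤? b)
... | true  = cong suc (countAbove-map-suc j μ)
... | false = countAbove-map-suc j μ

countAbove-dropZeros : ∀ j μ → countAbove j (dropZeros μ) ≡ countAbove j μ
countAbove-dropZeros j []          = refl
countAbove-dropZeros j (zero ∷ μ)  = countAbove-dropZeros j μ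
countAbove-dropZeros j (suc b ∷ μ) with does (suc j ≤? suc b)
... | true  = cong suc (countAbove-dropZeros j μ)
... | false = countAbove-dropZeros j μ

dropZeros-map-suc : ∀ μ → dropZeros (map suc μ) ≡ map suc μ
dropZeros-map-suc []      = refl
dropZeros-map-suc (b ∷ μ) = cong (suc b ∷_) (dropZeros-map-suc μ)

countAbove-0-map-suc : ∀ μ → countAbove 0 (map suc μ) ≡ length μ
countAbove-0-map-suc μ = trans (cong length (dropZeros-map-suc μ)) (length-map suc μ)

dropZeros-∷ʳ-0 : ∀ μ → dropZeros (μ ++ [ 0 ]) ≡ dropZeros μ
dropZeros-∷ʳ-0 μ = trans (filter-++ (1 ≤?_) μ [ 0 ]) (++-identityʳ (dropZeros μ))

dropZeros-below-0 : ∀ {μ} → Linked _≥_ (0 ∷ μ) → dropZeros μ ≡ []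
dropZeros-below-0 {[]}        _            = refl
dropZeros-below-0 {zero ∷ μ}  (_ ∷ 0≥μ)    = dropZeros-below-0 0≥μ
dropZeros-below-0 {suc _ ∷ _} (() ∷ _)

conjugate-map-suc : ∀ {a as} → Linked _≥_ (a ∷ as) →
  conjugate (map suc (a ∷ as)) ≡ length (a ∷ as) ∷ conjugate (dropZeros (a ∷ as))
conjugate-map-suc {zero} {as} a≥as =
  cong₂ _∷_ (cong suc (countAbove-0-map-suc as)) (cong conjugate (sym (dropZeros-below-0 a≥as)))
conjugate-map-suc {suc a} {as} _ = cong₂ _∷_ (cong suc (countAbove-0-map-suc as)) (begin
  map (count (suc (suc a) ∷ map suc as)) (applyUpTo suc (suc a))  ≡⟨ map-applyUpTo suc _ (suc a) ⟩
  applyUpTo (count (map suc (suc a ∷ as)) ∘ suc) (suc a)          ≡⟨ sym (map-upTo _ (suc a)) ⟩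
  map (count (map suc (suc a ∷ as)) ∘ suc) (upTo (suc a))          ≡⟨ map-cong shift (upTo (suc a)) ⟩
  map (count (suc a ∷ dropZeros as)) (upTo (suc a))                ∎)
  where
  count : List ℕ → ℕ → ℕ
  count μ j = countAbove j μ
  shift : ∀ j → countAbove (suc j) (map suc (suc a ∷ as)) ≡ countAbove j (dropZeros (suc a ∷ as))
  shift j = trans (countAbove-map-suc j (suc a ∷ as)) (sym (countAbove-dropZeros j (suc a ∷ as)))

-- Words are read from the top: beadParts records the spacers below each bead,
-- spacerParts the beads above each spacer (largest first).
spacers : List Bool → ℕ
spacers []          = 0
spacers (true ∷ w)  = spacers w
spacers (false ∷ w) = suc (spacers w)

beads : List Bool → ℕ
beads []          = 0
beads (true ∷ w)  = suc (beads w)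
beads (false ∷ w) = beads w

beadParts : List Bool → List ℕ
beadParts []          = []
beadParts (true ∷ w)  = spacers w ∷ beadParts w
beadParts (false ∷ w) = beadParts w

spacerParts : List Bool → List ℕ
spacerParts []          = []
spacerParts (true ∷ w)  = map suc (spacerParts w)
spacerParts (false ∷ w) = spacerParts w ++ [ 0 ]

spacers+beads : ∀ w → spacers w + beads w ≡ length w
spacers+beads []          = refl
spacers+beads (true ∷ w)  = trans (+-suc (spacers w) (beads w)) (cong suc (spacers+beads w))
spacers+beads (false ∷ w) = cong suc (spacers+beads w)

length-spacerParts : ∀ w → length (spacerParts w) ≡ spacers w
length-spacerParts []          = refl
length-spacerParts (true ∷ w)  = trans (length-map suc (spacerParts w)) (length-spacerParts w)
length-spacerParts (false ∷ w) = begin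
  length (spacerParts w ++ [ 0 ])  ≡⟨ length-++ (spacerParts w) ⟩
  length (spacerParts w) + 1       ≡⟨ +-comm (length (spacerParts w)) 1 ⟩
  suc (length (spacerParts w))     ≡⟨ cong suc (length-spacerParts w) ⟩
  suc (spacers w)                  ∎

∷ʳ-0⁺ : ∀ {μ} → Linked _≥_ μ → Linked _≥_ (μ ++ [ 0 ])
∷ʳ-0⁺ []         = [-]
∷ʳ-0⁺ [-]        = z≤n ∷ [-]
∷ʳ-0⁺ (a≥b ∷ μ↘) = a≥b ∷ ∷ʳ-0⁺ μ↘

spacerParts-decreasing : ∀ w → Linked _≥_ (spacerParts w)
spacerParts-decreasing []          = []
spacerParts-decreasing (true ∷ w)  = Linked.map⁺ (Linked.map s≤s (spacerParts-decreasing w))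
spacerParts-decreasing (false ∷ w) = ∷ʳ-0⁺ (spacerParts-decreasing w)

conjugate-map-suc-dropZeros : ∀ {μ ν} → Linked _≥_ μ → conjugate (dropZeros μ) ≡ dropZeros ν →
  conjugate (dropZeros (map suc μ)) ≡ dropZeros (length μ ∷ ν)
conjugate-map-suc-dropZeros {[]}     _  eq = eq
conjugate-map-suc-dropZeros {a ∷ as} {ν} μ↘ eq = begin
  conjugate (dropZeros (map suc (a ∷ as)))          ≡⟨ cong conjugate (dropZeros-map-suc (a ∷ as)) ⟩
  conjugate (map suc (a ∷ as))                      ≡⟨ conjugate-map-suc μ↘ ⟩
  length (a ∷ as) ∷ conjugate (dropZeros (a ∷ as))  ≡⟨ cong (length (a ∷ as) ∷_) eq ⟩
  length (a ∷ as) ∷ dropZeros ν                     ∎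

conjugate-spacerParts : ∀ w → conjugate (dropZeros (spacerParts w)) ≡ dropZeros (beadParts w)
conjugate-spacerParts []          = refl
conjugate-spacerParts (true ∷ w)  rewrite sym (length-spacerParts w) =
  conjugate-map-suc-dropZeros (spacerParts-decreasing w) (conjugate-spacerParts w)
conjugate-spacerParts (false ∷ w) =
  trans (cong conjugate (dropZeros-∷ʳ-0 (spacerParts w))) (conjugate-spacerParts w)

spacers-∷ʳ-true : ∀ w → spacers (w ++ [ true ]) ≡ spacers w
spacers-∷ʳ-true []          = refl
spacers-∷ʳ-true (true ∷ w)  = spacers-∷ʳ-true w
spacers-∷ʳ-true (false ∷ w) = cong suc (spacers-∷ʳ-true w)

spacers-∷ʳ-false : ∀ w → spacers (w ++ [ false ]) ≡ suc (spacers w)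
spacers-∷ʳ-false []          = refl
spacers-∷ʳ-false (true ∷ w)  = spacers-∷ʳ-false w
spacers-∷ʳ-false (false ∷ w) = cong suc (spacers-∷ʳ-false w)

beadParts-∷ʳ-true : ∀ w → beadParts (w ++ [ true ]) ≡ beadParts w ++ [ 0 ]
beadParts-∷ʳ-true []          = refl
beadParts-∷ʳ-true (true ∷ w)  = cong₂ _∷_ (spacers-∷ʳ-true w) (beadParts-∷ʳ-true w)
beadParts-∷ʳ-true (false ∷ w) = beadParts-∷ʳ-true w

beadParts-∷ʳ-false : ∀ w → beadParts (w ++ [ false ]) ≡ map suc (beadParts w)
beadParts-∷ʳ-false []          = refl
beadParts-∷ʳ-false (true ∷ w)  = cong₂ _∷_ (spacers-∷ʳ-false w) (beadParts-∷ʳ-false w)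
beadParts-∷ʳ-false (false ∷ w) = beadParts-∷ʳ-false w

beadParts-reverse-complement : ∀ w → beadParts (reverse (map not w)) ≡ spacerParts w
beadParts-reverse-complement []          = refl
beadParts-reverse-complement (true ∷ w)  = begin
  beadParts (reverse (false ∷ map not w))      ≡⟨ cong beadParts (unfold-reverse false (map not w)) ⟩
  beadParts (reverse (map not w) ++ [ false ]) ≡⟨ beadParts-∷ʳ-false (reverse (map not w)) ⟩
  map suc (beadParts (reverse (map not w)))    ≡⟨ cong (map suc) (beadParts-reverse-complement w) ⟩
  map suc (spacerParts w)                      ∎
beadParts-reverse-complement (false ∷ w) = begin
  beadParts (reverse (true ∷ map not w))      ≡⟨ cong beadParts (unfold-reverse true (map not w)) ⟩
  beadParts (reverse (map not w) ++ [ true ]) ≡⟨ beadParts-∷ʳ-true (reverse (map not w)) ⟩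
  beadParts (reverse (map not w)) ++ [ 0 ]    ≡⟨ cong (_++ [ 0 ]) (beadParts-reverse-complement w) ⟩
  spacerParts w ++ [ 0 ]                      ∎

beadParts-selfConjugate : ∀ w → w ≡ reverse (map not w) → SelfConjugate (dropZeros (beadParts w))
beadParts-selfConjugate w w≡rev = begin
  conjugate (dropZeros (beadParts w))                      ≡⟨ cong (conjugate ∘ dropZeros ∘ beadParts) w≡rev ⟩
  conjugate (dropZeros (beadParts (reverse (map not w))))  ≡⟨ cong (conjugate ∘ dropZeros)
                                                                    (beadParts-reverse-complement w) ⟩
  conjugate (dropZeros (spacerParts w))                    ≡⟨ conjugate-spacerParts w ⟩
  dropZeros (beadParts w)                                  ∎

applyDownFrom-cong : ∀ {A : Set} {f g : ℕ → A} n → (∀ {x} → x < n → f x ≡ g x) →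
  applyDownFrom f n ≡ applyDownFrom g n
applyDownFrom-cong zero    _    = refl
applyDownFrom-cong (suc n) f≡g = cong₂ _∷_ (f≡g (n<1+n n)) (applyDownFrom-cong n (f≡g ∘ m<n⇒m<1+n))

applyDownFrom-reflect : ∀ {A : Set} n (h : ℕ → A) → applyDownFrom (λ x → h (n ∸ suc x)) n ≡ applyUpTo h n
applyDownFrom-reflect zero    h = refl
applyDownFrom-reflect (suc n) h = cong₂ _∷_ (cong h (n∸n≡0 n)) (begin
  applyDownFrom (λ x → h (n ∸ x)) n            ≡⟨ applyDownFrom-cong n (λ x<n → cong h (+-∸-assoc 1 x<n)) ⟩
  applyDownFrom (λ x → h (suc (n ∸ suc x))) n  ≡⟨ applyDownFrom-reflect n (h ∘ suc) ⟩
  applyUpTo (h ∘ suc) n                        ∎)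

beadWord : ℕ → List ℕ → List Bool
beadWord n X = applyDownFrom (λ x → does (x ∈? X)) n

beadWord-cong : ∀ n {X Y} → (∀ {x} → x < n → (x ∈ X) ⇔ (x ∈ Y)) → beadWord n X ≡ beadWord n Y
beadWord-cong n {X} {Y} X⇔Y = applyDownFrom-cong n (λ {x} x<n → does-⇔ (X⇔Y x<n) (x ∈? X) (x ∈? Y))

beadWord-suc-∉ : ∀ {n X} → n ∉ X → beadWord (suc n) X ≡ false ∷ beadWord n X
beadWord-suc-∉ {n} {X} n∉X = cong (_∷ beadWord n X) (dec-false (n ∈? X) n∉X)

beadWord-suc-∷ : ∀ n X → beadWord (suc n) (n ∷ X) ≡ true ∷ beadWord n X
beadWord-suc-∷ n X =
  cong₂ _∷_ (dec-true (n ∈? n ∷ X) (here refl)) (beadWord-cong n (λ x<n → mk⇔ (drop x<n) there))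
  where
  drop : ∀ {x} → x < n → x ∈ n ∷ X → x ∈ X
  drop x<n (here refl) = contradiction refl (<⇒≢ x<n)
  drop _   (there x∈X) = x∈X

-- partsOf lists the parts of a partition from its bead positions x₁ > ⋯ > x_k: the
-- i-th part is x_i − (k − i).
partsOf : List ℕ → List ℕ
partsOf []      = []
partsOf (d ∷ D) = d ∸ length D ∷ partsOf D

below-head : ∀ {d D} → Linked _>_ (d ∷ D) → All (_< d) D
below-head [-]          = []
below-head (d>e ∷ e>E) = Linked.Linked⇒All (λ x>y y>z → <-trans y>z x>y) d>e e>E

∉-above : ∀ {n D} → All (_< n) D → n ∉ D
∉-above D<n n∈D = <-irrefl refl (All.lookup D<n n∈D)

data TopView (n : ℕ) : List ℕ → Set where
  below : ∀ {D} → All (_< n) D → TopView n D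
  top   : ∀ {D} → All (_< n) D → TopView n (n ∷ D)

topView : ∀ {n D} → Linked _>_ D → All (_< suc n) D → TopView n D
topView {n} {[]}    _  []          = below []
topView {n} {d ∷ D} D↘ (d<1+n ∷ _) with d ≟ n
... | yes refl = top (below-head D↘)
... | no  d≢n  = below (d<n ∷ All.map (λ x<d → <-trans x<d d<n) (below-head D↘))
  where d<n = ≤∧≢⇒< (s≤s⁻¹ d<1+n) d≢n

beads-beadWord : ∀ n {D} → Linked _>_ D → All (_< n) D → beads (beadWord n D) ≡ length D
beads-beadWord zero    {[]}    _  []       = refl
beads-beadWord zero    {_ ∷ _} _  (() ∷ _)
beads-beadWord (suc n)         D↘ D<1+n with topView D↘ D<1+n
... | below D<n = trans (cong beads (beadWord-suc-∉ (∉-above D<n))) (beads-beadWord n D↘ D<n)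
... | top {D} D<n =
  trans (cong beads (beadWord-suc-∷ n D)) (cong suc (beads-beadWord n (Linked.tail D↘) D<n))

spacers-beadWord : ∀ n {D} → Linked _>_ D → All (_< n) D → spacers (beadWord n D) ≡ n ∸ length D
spacers-beadWord n {D} D↘ D<n = begin
  spacers w                      ≡⟨ m+n∸n≡m (spacers w) (beads w) ⟨
  spacers w + beads w ∸ beads w  ≡⟨ cong₂ _∸_ (trans (spacers+beads w) (length-applyDownFrom _ n))
                                              (beads-beadWord n D↘ D<n) ⟩
  n ∸ length D                   ∎
  where w = beadWord n D

beadParts-beadWord : ∀ n {D} → Linked _>_ D → All (_< n) D → beadParts (beadWord n D) ≡ partsOf D
beadParts-beadWord zero    {[]}    _  []       = refl
beadParts-beadWord zero    {_ ∷ _} _  (() ∷ _)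
beadParts-beadWord (suc n)         D↘ D<1+n with topView D↘ D<1+n
... | below D<n = trans (cong beadParts (beadWord-suc-∉ (∉-above D<n))) (beadParts-beadWord n D↘ D<n)
... | top {D} D<n = trans (cong beadParts (beadWord-suc-∷ n D))
  (cong₂ _∷_ (spacers-beadWord n (Linked.tail D↘) D<n) (beadParts-beadWord n (Linked.tail D↘) D<n))

sortedBeadSet : ℕ → List ℕ → List ℕ
sortedBeadSet m λs = map (_+ m) (hooks λs) ++ downFrom m

∈-beadSet⇔∈-sortedBeadSet : ∀ m λs {x} → (x ∈ beadSet m λs) ⇔ (x ∈ sortedBeadSet m λs)
∈-beadSet⇔∈-sortedBeadSet m λs = mk⇔
  ([ ∈-++⁺ʳ H ∘ ∈-downFrom⁺ ∘ ∈-upTo⁻ , ∈-++⁺ˡ ]′ ∘ ∈-++⁻ (upTo m))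
  ([ ∈-++⁺ʳ (upTo m) , ∈-++⁺ˡ ∘ ∈-upTo⁺ ∘ ∈-downFrom⁻ ]′ ∘ ∈-++⁻ H)
  where H = map (_+ m) (hooks λs)

hooks-decreasing : ∀ {λs} → Linked _≥_ λs → Linked _>_ (hooks λs)
hooks-decreasing []                      = []
hooks-decreasing [-]                     = [-]
hooks-decreasing {_ ∷ _ ∷ bs} (a≥b ∷ λ↘) =
  +-mono-≤-< a≥b (n<1+n (length bs)) ∷ hooks-decreasing λ↘

++⁺-separated : ∀ {m xs ys} → Linked _>_ xs → Linked _>_ ys → All (m ≤_) xs → All (_< m) ys →
  Linked _>_ (xs ++ ys)
++⁺-separated []           ys↘ _              _             = ys↘
++⁺-separated [-]          []  _              _             = [-]
++⁺-separated [-]          ys↘ (m≤x ∷ _)      (y<m ∷ _)     = <-≤-trans y<m m≤x ∷ ys↘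
++⁺-separated (x>y ∷ xs↘)  ys↘ (_ ∷ m≤xs)     ys<m          =
  x>y ∷ ++⁺-separated xs↘ ys↘ m≤xs ys<m

sortedBeadSet-decreasing : ∀ m {λs} → Linked _≥_ λs → Linked _>_ (sortedBeadSet m λs)
sortedBeadSet-decreasing m {λs} λ↘ = ++⁺-separated
  (Linked.map⁺ (Linked.map (+-monoˡ-< m) (hooks-decreasing λ↘)))
  (Linked.applyDownFrom⁺₂ id m n<1+n)
  (All.map⁺ (All.universal (m≤n+m m) (hooks λs)))
  (All.tabulate ∈-downFrom⁻)

length-hooks : ∀ λs → length (hooks λs) ≡ length λs
length-hooks []       = refl
length-hooks (a ∷ as) = cong suc (length-hooks as)

length-sortedBeadSet : ∀ m λs → length (sortedBeadSet m λs) ≡ length λs + m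
length-sortedBeadSet m λs = begin
  length (map (_+ m) (hooks λs) ++ downFrom m)             ≡⟨ length-++ (map (_+ m) (hooks λs)) ⟩
  length (map (_+ m) (hooks λs)) + length (downFrom m)     ≡⟨ cong₂ _+_ (length-map (_+ m) (hooks λs))
                                                                         (length-downFrom m) ⟩
  length (hooks λs) + m                                    ≡⟨ cong (_+ m) (length-hooks λs) ⟩
  length λs + m                                            ∎

partsOf-sortedBeadSet : ∀ m λs → partsOf (sortedBeadSet m λs) ≡ λs ++ partsOf (downFrom m)
partsOf-sortedBeadSet m []       = refl
partsOf-sortedBeadSet m (a ∷ as) = cong₂ _∷_ (begin
  a + length as + m ∸ length (sortedBeadSet m as)  ≡⟨ cong₂ _∸_ (+-assoc a (length as) m)
                                                                (length-sortedBeadSet m as) ⟩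
  a + (length as + m) ∸ (length as + m)            ≡⟨ m+n∸n≡m a (length as + m) ⟩
  a                                                ∎) (partsOf-sortedBeadSet m as)

dropZeros-partsOf-downFrom : ∀ m → dropZeros (partsOf (downFrom m)) ≡ []
dropZeros-partsOf-downFrom zero    = refl
dropZeros-partsOf-downFrom (suc m) rewrite length-downFrom m | n∸n≡0 m = dropZeros-partsOf-downFrom m

dropZeros-partsOf-sortedBeadSet : ∀ m {λs} → All (_> 0) λs → dropZeros (partsOf (sortedBeadSet m λs)) ≡ λs
dropZeros-partsOf-sortedBeadSet m {λs} λ>0 = begin
  dropZeros (partsOf (sortedBeadSet m λs))          ≡⟨ cong dropZeros (partsOf-sortedBeadSet m λs) ⟩
  dropZeros (λs ++ partsOf (downFrom m))            ≡⟨ filter-++ (1 ≤?_) λs (partsOf (downFrom m)) ⟩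
  dropZeros λs ++ dropZeros (partsOf (downFrom m))  ≡⟨ cong₂ _++_ (filter-all (1 ≤?_) λ>0)
                                                                  (dropZeros-partsOf-downFrom m) ⟩
  λs ++ []                                          ≡⟨ ++-identityʳ λs ⟩
  λs                                                ∎

beadParts-beadWord-beadSet : ∀ n m {λs} → IsPartition λs → All (_< n) (beadSet m λs) →
  dropZeros (beadParts (beadWord n (beadSet m λs))) ≡ λs
beadParts-beadWord-beadSet n m {λs} (λ↘ , λ>0) X<n = begin
  dropZeros (beadParts (beadWord n (beadSet m λs)))        ≡⟨ cong (dropZeros ∘ beadParts) same-word ⟩
  dropZeros (beadParts (beadWord n (sortedBeadSet m λs)))  ≡⟨ cong dropZeros (beadParts-beadWord n sorted↘ sorted<n) ⟩
  dropZeros (partsOf (sortedBeadSet m λs))                 ≡⟨ dropZeros-partsOf-sortedBeadSet m λ>0 ⟩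
  λs                                                       ∎
  where
  same-word : beadWord n (beadSet m λs) ≡ beadWord n (sortedBeadSet m λs)
  same-word = beadWord-cong n (λ _ → ∈-beadSet⇔∈-sortedBeadSet m λs)
  sorted↘ : Linked _>_ (sortedBeadSet m λs)
  sorted↘ = sortedBeadSet-decreasing m λ↘
  sorted<n : All (_< n) (sortedBeadSet m λs)
  sorted<n = All.tabulate (All.lookup X<n ∘ Equivalence.from (∈-beadSet⇔∈-sortedBeadSet m λs))

ComplementSymmetric : ℕ → List ℕ → Set
ComplementSymmetric n X = ∀ {x} → x < n → (x ∈ X) ⇔ (¬ (n ∸ suc x ∈ X))

beadWord-complementSymmetric : ∀ {n X} → ComplementSymmetric n X →
  beadWord n X ≡ reverse (map not (beadWord n X))
beadWord-complementSymmetric {n} {X} sym-X = begin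
  applyDownFrom f n                            ≡⟨ applyDownFrom-cong n (λ {x} x<n →
                                                    does-⇔ (sym-X x<n) (x ∈? X) (¬? (n ∸ suc x ∈? X))) ⟩
  applyDownFrom (λ x → not (f (n ∸ suc x))) n  ≡⟨ applyDownFrom-reflect n (not ∘ f) ⟩
  applyUpTo (not ∘ f) n                        ≡⟨ reverse-applyDownFrom (not ∘ f) n ⟨
  reverse (applyDownFrom (not ∘ f) n)          ≡⟨ cong reverse (map-applyDownFrom f not n) ⟨
  reverse (map not (applyDownFrom f n))        ∎
  where
  f : ℕ → Bool
  f x = does (x ∈? X)

-- Reflecting (i, j) through both axes of an abacus with s + 1 runners and q + 1 rows
-- gives (s − i, q − j), i.e. the integer x becomes N − 1 − x.
reflect-position : ∀ {s q i j} → i ≤ s → j ≤ q →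
  s ∸ i + (q ∸ j) * suc s ≡ suc q * suc s ∸ suc (i + j * suc s)
reflect-position {s} {q} {i} {j} i≤s j≤q = begin
  y                      ≡⟨ m+n∸n≡m y (suc x) ⟨
  y + suc x ∸ suc x      ≡⟨ cong (_∸ suc x) y+1+x≡N ⟩
  suc q * suc s ∸ suc x  ∎
  where
  x = i + j * suc s
  y = s ∸ i + (q ∸ j) * suc s
  rearrange : ∀ a b i j S → a + b * S + suc (i + j * S) ≡ suc (a + i) + (b + j) * S
  rearrange = solve-∀
  y+1+x≡N : y + suc x ≡ suc q * suc s
  y+1+x≡N = begin
    y + suc x                                 ≡⟨ rearrange (s ∸ i) (q ∸ j) i j (suc s) ⟩
    suc (s ∸ i + i) + (q ∸ j + j) * suc s     ≡⟨ cong₂ (λ a b → suc a + b * suc s)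
                                                         (m∸n+n≡m i≤s) (m∸n+n≡m j≤q) ⟩
    suc s + q * suc s                         ∎

abacus-complementSymmetric : ∀ s q {X} → HorizAntiSym (suc s) (suc q) X → VertSym (suc s) (suc q) X →
  ComplementSymmetric (suc q * suc s) X
abacus-complementSymmetric s q {X} horiz vert {x} x<N = mk⇔
  (λ x∈X y∈X → proj₁ row-flip (subst (_∈ X) x≡ij x∈X)
                               (proj₂ column-flip (subst (_∈ X) (sym y≡) y∈X)))
  (λ y∉X → subst (_∈ X) (sym x≡ij) (proj₂ row-flip (y∉X ∘ subst (_∈ X) y≡ ∘ proj₁ column-flip)))
  where
  i = x % suc s
  j = x / suc s
  x≡ij : x ≡ i + j * suc s
  x≡ij = m≡m%n+[m/n]*n x (suc s)
  i<S : i < suc s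
  i<S = m%n<n x (suc s)
  j<Q : j < suc q
  j<Q = m<n*o⇒m/o<n x<N
  y≡ : s ∸ i + (q ∸ j) * suc s ≡ suc q * suc s ∸ suc x
  y≡ = trans (reflect-position (s≤s⁻¹ i<S) (s≤s⁻¹ j<Q)) (cong (λ t → suc q * suc s ∸ suc t) (sym x≡ij))
  row-flip : (HasBead (suc s) X i j → ¬ HasBead (suc s) X i (q ∸ j)) ×
             (¬ HasBead (suc s) X i (q ∸ j) → HasBead (suc s) X i j)
  row-flip = horiz i j i<S j<Q
  column-flip : (HasBead (suc s) X i (q ∸ j) → HasBead (suc s) X (s ∸ i) (q ∸ j)) ×
                (HasBead (suc s) X (s ∸ i) (q ∸ j) → HasBead (suc s) X i (q ∸ j))
  column-flip = vert i (q ∸ j) i<S (s≤s (m∸n≤m q j))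

m/n≡o⇒m<[1+o]*n : ∀ {m n o} .{{_ : NonZero n}} → m / n ≡ o → m < suc o * n
m/n≡o⇒m<[1+o]*n {m} {n} refl =
  subst (_< suc (m / n) * n) (sym (m≡m%n+[m/n]*n m n)) (+-monoˡ-< (m / n * n) (m%n<n m n))

corollary4p9 : (s : ℕ) → .{{_ : NonZero s}} → (λs : List ℕ) → IsPartition λs →
    (m : ℕ) → IsNormalizingShift s λs m →
    (q : ℕ) → 0 < q → LargestInRow s (beadSet m λs) (q ∸ 1) →
    HorizAntiSym s q (beadSet m λs) → VertSym s q (beadSet m λs) →
    SelfConjugate λs
corollary4p9 zero {{s≢0}} _ _ _ _ _ _ _ _ _ = ⊥-elim (≢-nonZero⁻¹ zero {{s≢0}} refl)
corollary4p9 (suc s) λs isPartition m _ (suc q) _ (x , _ , X≤x , x-row) horiz vert =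
  subst SelfConjugate (beadParts-beadWord-beadSet N m isPartition X<N)
    (beadParts-selfConjugate (beadWord N X)
      (beadWord-complementSymmetric (abacus-complementSymmetric s q horiz vert)))
  where
  X = beadSet m λs
  N = suc q * suc s
  X<N : All (_< N) X
  X<N = All.map (λ y≤x → ≤-<-trans y≤x (m/n≡o⇒m<[1+o]*n x-row)) X≤x
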